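{- Let $m\ge 1$, $n=2^m-1$, and let $H\subset F^n$ be the Hamming code and, for $\iota\in\dot F^m$, let $R_\iota$ be the linear $\iota$-component of $H$ (as defined in the context). Then for every $\iota\in\dot F^m$ and every $\bar z\in F^n$, $$\Omega(R_\iota+\bar z)=\Omega(R_\iota+\bar z+\bar e^{(\iota)}).$$
   Context: $F^m$ denotes the vector space of binary $m$-tuples over $GF(2)$, and $\dot F^m=F^m\setminus\{0^m\}$. Let $n=2^m-1$. Elements of $F^n$ are written $\bar w=\{w_\iota\}_{\iota\in\dot F^m}$, i.e. their coordinates are indexed by the nonzero vectors of $F^m$; $\{\bar e^{(\iota)}\}_{\iota\in\dot F^m}$ is the standard basis of $F^n$ ($\bar e^{(\iota)}$ has a single $1$ in coordinate $\iota$). The Hamming distance is $d(\cdot,\cdot)$. For $M\subset F^n$, the neighborhood $\Omega(M)$ is the set of vectors of $F^n$ at Hamming distance at most $1$ from some element of $M$. The Hamming code is $H=\{\bar c\in F^n : \sum_{\alpha\in\dot F^m} c_\alpha\alpha=0^m\}$. For $\iota\in\dot F^m$, the linear $\iota$-component of $H$ is $R_\iota=\{\bar c\in H : c_\alpha=c_{\alpha+\iota}\text{ for all }\alpha\in F^m\setminus\langle\iota\rangle\}$, where $\langle\cdot\rangle$ denotes linear span. -}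

module Defs where

open import Data.Bool using (Bool; true; false; _xor_; _∧_; if_then_else_)
open import Data.Nat using (ℕ; zero; suc; _+_; _≤_)
open import Data.Vec using (Vec; []; _∷_; replicate; zipWith)
open import Data.List using (List; []; _∷_; _++_; map; length; filter)
open import Data.Product using (Σ; _×_; ∃; _,_)
open import Relation.Binary.PropositionalEquality using (_≡_; _≢_)
open import Relation.Nullary using (¬_; Dec; yes; no)
open import Relation.Nullary.Decidable using (¬?)
open import Data.Vec.Properties using (≡-dec)
import Data.Bool.Properties as BP

Fm : ℕ → Set
Fm m = Vec Bool m

0ᵐ : (m : ℕ) → Fm m
0ᵐ m = replicate m false

_⊕_ : {m : ℕ} → Fm m → Fm m → Fm m
_⊕_ = zipWith _xor_

_·_ : {m : ℕ} → Bool → Fm m → Fm m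
true  · v = v
false · v = replicate _ false

_≟ᵥ_ : {m : ℕ} → (u v : Fm m) → Dec (u ≡ v)
_≟ᵥ_ = ≡-dec BP._≟_

allFm : (m : ℕ) → List (Fm m)
allFm zero = [] ∷ []
allFm (suc m) = map (true ∷_) (allFm m) ++ map (false ∷_) (allFm m)

nonzeroFm : (m : ℕ) → List (Fm m)
nonzeroFm m = filter (λ v → ¬? (v ≟ᵥ 0ᵐ m)) (allFm m)

-- F^n with n = 2^m - 1: words indexed by the nonzero vectors of F^m.
-- Represented as functions on F^m; the value at 0ᵐ is never used.
Word : ℕ → Set
Word m = Fm m → Bool

_≈w_ : {m : ℕ} → Word m → Word m → Set
_≈w_ {m} u v = (α : Fm m) → α ≢ 0ᵐ m → u α ≡ v α

_+w_ : {m : ℕ} → Word m → Word m → Word m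
(u +w v) α = u α xor v α

e : {m : ℕ} → Fm m → Word m
e ι α with α ≟ᵥ ι
... | yes _ = true
... | no  _ = false

dist : {m : ℕ} → Word m → Word m → ℕ
dist {m} u v = length (filter (λ α → BP.T? (u α xor v α)) (nonzeroFm m))

sumF : {m : ℕ} → List (Fm m) → Fm m
sumF {m} [] = 0ᵐ m
sumF (x ∷ xs) = x ⊕ sumF xs

Hamming : (m : ℕ) → Word m → Set
Hamming m c = sumF (map (λ α → c α · α) (nonzeroFm m)) ≡ 0ᵐ m

-- linear ι-component R_ι of H:
-- c ∈ H and c_α = c_{α+ι} for all α ∈ F^m ∖ ⟨ι⟩ = F^m ∖ {0, ι}
Rcomp : (m : ℕ) → Fm m → Word m → Set
Rcomp m ι c = Hamming m c ×
  ((α : Fm m) → α ≢ 0ᵐ m → α ≢ ι → c α ≡ c (α ⊕ ι))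

_+ˢ_ : {m : ℕ} → (Word m → Set) → Word m → (Word m → Set)
(M +ˢ z) w = Σ _ λ c → M c × (w ≈w (c +w z))

Ω : {m : ℕ} → (Word m → Set) → (Word m → Set)
Ω M w = Σ _ λ c → M c × dist c w ≤ 1

module Submission where

-- Put Rᵥ = R_ι + v.  The heart of the argument is the
-- inclusion  Ω(Rᵥ) ⊆ Ω(Rᵥ + e^ι)  for EVERY translate v.  If x ∈ Rᵥ and
-- d(x,w) ≤ 1, then x + w = e^γ for some γ (γ = 0 covers x = w, since the
-- coordinate 0 does not exist).  The word  t = e^ι + e^γ + e^{γ+ι}  lies in
-- R_ι, R_ι is linear, and  (x + t + e^ι) + w = e^{γ+ι};  so x + t + e^ι is a
-- word of Rᵥ + e^ι at distance ≤ 1 from w.  The reverse inclusion is the same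
-- statement for the translate v + e^ι, because (Rᵥ + e^ι) + e^ι = Rᵥ.

open import Defs
open import Data.Nat using (ℕ; zero; suc; _≥_; _≤_; z≤n; s≤s)
open import Data.Bool using (true; false; _xor_)
import Data.Bool.Properties as BP
open import Data.Bool.Solver using (module xor-∧-Solver)
open import Data.Vec using ([]; _∷_)
import Data.Vec.Properties as VP
open import Data.List using (List; []; _∷_; map; filter; length)
open import Data.List.Membership.Propositional using (_∈_; _∉_)
open import Data.List.Membership.Propositional.Properties
  using (∉[]; ∈-map⁺; ∈-map⁻; ∈-++⁺ˡ; ∈-++⁺ʳ; ∈-filter⁺; ∈-filter⁻)
open import Data.List.Relation.Unary.Any using (here; there)
open import Data.List.Relation.Unary.All using (All; []; _∷_; tabulate)
open import Data.List.Relation.Unary.AllPairs using ([]; _∷_)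
open import Data.List.Relation.Unary.Unique.Propositional using (Unique)
import Data.List.Relation.Unary.Unique.Propositional.Properties as Unique
open import Data.List.Relation.Binary.Disjoint.Propositional using (Disjoint)
open import Data.Product using (Σ; _×_; _,_; proj₂)
open import Data.Empty using (⊥-elim)
open import Function using (_∘_; Equivalence)
open import Relation.Nullary using (yes; no; ¬?)
open import Relation.Nullary.Decidable using (T?)
open import Relation.Unary using (_⊆_)
open import Relation.Binary.PropositionalEquality
  using (_≡_; _≢_; refl; sym; trans; cong; cong₂; subst; module ≡-Reasoning)

⊕-assoc : ∀ {m} (x y z : Fm m) → (x ⊕ y) ⊕ z ≡ x ⊕ (y ⊕ z)
⊕-assoc = VP.zipWith-assoc BP.xor-assoc

⊕-comm : ∀ {m} (x y : Fm m) → x ⊕ y ≡ y ⊕ x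
⊕-comm = VP.zipWith-comm BP.xor-comm

⊕-identityˡ : ∀ {m} (x : Fm m) → 0ᵐ m ⊕ x ≡ x
⊕-identityˡ = VP.zipWith-identityˡ BP.xor-identityˡ

⊕-identityʳ : ∀ {m} (x : Fm m) → x ⊕ 0ᵐ m ≡ x
⊕-identityʳ = VP.zipWith-identityʳ BP.xor-identityʳ

⊕-self : ∀ {m} (x : Fm m) → x ⊕ x ≡ 0ᵐ m
⊕-self []      = refl
⊕-self (a ∷ x) = cong₂ _∷_ (BP.xor-same a) (⊕-self x)

⊕-cancelʳ : ∀ {m} (x y : Fm m) → (x ⊕ y) ⊕ y ≡ x
⊕-cancelʳ x y = begin
  (x ⊕ y) ⊕ y  ≡⟨ ⊕-assoc x y y ⟩
  x ⊕ (y ⊕ y)  ≡⟨ cong (x ⊕_) (⊕-self y) ⟩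
  x ⊕ 0ᵐ _     ≡⟨ ⊕-identityʳ x ⟩
  x            ∎
  where open ≡-Reasoning

⊕-shift : ∀ {m} {x y : Fm m} (ι : Fm m) → x ⊕ ι ≡ y → x ≡ y ⊕ ι
⊕-shift {x = x} ι refl = sym (⊕-cancelʳ x ι)

⊕-interchange : ∀ {m} (a b c d : Fm m) → (a ⊕ b) ⊕ (c ⊕ d) ≡ (a ⊕ c) ⊕ (b ⊕ d)
⊕-interchange a b c d = begin
  (a ⊕ b) ⊕ (c ⊕ d)  ≡⟨ ⊕-assoc a b (c ⊕ d) ⟩
  a ⊕ (b ⊕ (c ⊕ d))  ≡⟨ cong (a ⊕_) (sym (⊕-assoc b c d)) ⟩
  a ⊕ ((b ⊕ c) ⊕ d)  ≡⟨ cong (λ u → a ⊕ (u ⊕ d)) (⊕-comm b c) ⟩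
  a ⊕ ((c ⊕ b) ⊕ d)  ≡⟨ cong (a ⊕_) (⊕-assoc c b d) ⟩
  a ⊕ (c ⊕ (b ⊕ d))  ≡⟨ sym (⊕-assoc a c (b ⊕ d)) ⟩
  (a ⊕ c) ⊕ (b ⊕ d)  ∎
  where open ≡-Reasoning

·-distribʳ-xor : ∀ {m} a b (α : Fm m) → (a xor b) · α ≡ (a · α) ⊕ (b · α)
·-distribʳ-xor true  true  α = sym (⊕-self α)
·-distribʳ-xor true  false α = sym (⊕-identityʳ α)
·-distribʳ-xor false b     α = sym (⊕-identityˡ (b · α))

-- Indicator words: e γ is 1 exactly at the coordinate γ (for γ = 0 this is
-- the zero word, since the coordinate 0 is never inspected).

e-self : ∀ {m} (γ : Fm m) → e γ γ ≡ true
e-self γ with γ ≟ᵥ γ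
... | yes _   = refl
... | no  γ≢γ = ⊥-elim (γ≢γ refl)

e-other : ∀ {m} {γ α : Fm m} → α ≢ γ → e γ α ≡ false
e-other {γ = γ} {α} α≢γ with α ≟ᵥ γ
... | yes α≡γ = ⊥-elim (α≢γ α≡γ)
... | no  _   = refl

e-support : ∀ {m} {γ α : Fm m} → e γ α ≡ true → α ≡ γ
e-support {γ = γ} {α} _ with α ≟ᵥ γ
... | yes α≡γ = α≡γ
e-support () | no _

e-cong : ∀ {m} {γ α γ' α' : Fm m} →
  (α ≡ γ → α' ≡ γ') → (α' ≡ γ' → α ≡ γ) → e γ α ≡ e γ' α'
e-cong {γ = γ} {α} {γ'} to from with α ≟ᵥ γ
... | yes α≡γ = sym (trans (cong (e γ') (to α≡γ)) (e-self γ'))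
... | no  α≢γ = sym (e-other (α≢γ ∘ from))

e-translate : ∀ {m} (γ α ι : Fm m) → e γ (α ⊕ ι) ≡ e (γ ⊕ ι) α
e-translate γ α ι = e-cong (⊕-shift ι) (λ α≡γ⊕ι → trans (cong (_⊕ ι) α≡γ⊕ι) (⊕-cancelʳ γ ι))

allFm-complete : ∀ m (α : Fm m) → α ∈ allFm m
allFm-complete zero    []          = here refl
allFm-complete (suc m) (true ∷ α)  = ∈-++⁺ˡ (∈-map⁺ (true ∷_) (allFm-complete m α))
allFm-complete (suc m) (false ∷ α) =
  ∈-++⁺ʳ (map (true ∷_) (allFm m)) (∈-map⁺ (false ∷_) (allFm-complete m α))

allFm-unique : ∀ m → Unique (allFm m)
allFm-unique zero    = [] ∷ []
allFm-unique (suc m) = Unique.++⁺ (Unique.map⁺ VP.∷-injectiveʳ (allFm-unique m))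
                                  (Unique.map⁺ VP.∷-injectiveʳ (allFm-unique m))
                                  heads-differ
  where
  heads-differ : Disjoint (map (true ∷_) (allFm m)) (map (false ∷_) (allFm m))
  heads-differ (v∈₁ , v∈₂) with ∈-map⁻ (true ∷_) v∈₁ | ∈-map⁻ (false ∷_) v∈₂
  ... | _ , _ , refl | _ , _ , ()

nonzeroFm-complete : ∀ m {α : Fm m} → α ≢ 0ᵐ m → α ∈ nonzeroFm m
nonzeroFm-complete m {α} = ∈-filter⁺ (λ v → ¬? (v ≟ᵥ 0ᵐ m)) (allFm-complete m α)

nonzeroFm-nonzero : ∀ m {α : Fm m} → α ∈ nonzeroFm m → α ≢ 0ᵐ m
nonzeroFm-nonzero m = proj₂ ∘ ∈-filter⁻ (λ v → ¬? (v ≟ᵥ 0ᵐ m)) {xs = allFm m}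

nonzeroFm-unique : ∀ m → Unique (nonzeroFm m)
nonzeroFm-unique m = Unique.filter⁺ (λ v → ¬? (v ≟ᵥ 0ᵐ m)) (allFm-unique m)

syn : ∀ {m} → List (Fm m) → Word m → Fm m
syn L c = sumF (map (λ α → c α · α) L)

syn-+w : ∀ {m} (L : List (Fm m)) (c d : Word m) → syn L (c +w d) ≡ syn L c ⊕ syn L d
syn-+w []      c d = sym (⊕-identityˡ _)
syn-+w (α ∷ L) c d = begin
  ((c α xor d α) · α) ⊕ syn L (c +w d)            ≡⟨ cong₂ _⊕_ (·-distribʳ-xor (c α) (d α) α) (syn-+w L c d) ⟩
  ((c α · α) ⊕ (d α · α)) ⊕ (syn L c ⊕ syn L d)  ≡⟨ ⊕-interchange _ _ _ _ ⟩
  ((c α · α) ⊕ syn L c) ⊕ ((d α · α) ⊕ syn L d)  ∎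
  where open ≡-Reasoning

syn-e-absent : ∀ {m} {γ : Fm m} (L : List (Fm m)) → γ ∉ L → syn L (e γ) ≡ 0ᵐ m
syn-e-absent []      γ∉L = refl
syn-e-absent (α ∷ L) γ∉L = begin
  (e _ α · α) ⊕ syn L (e _)  ≡⟨ cong₂ _⊕_ (cong (_· α) (e-other (γ∉L ∘ here ∘ sym)))
                                         (syn-e-absent L (γ∉L ∘ there)) ⟩
  0ᵐ _ ⊕ 0ᵐ _                ≡⟨ ⊕-identityˡ _ ⟩
  0ᵐ _                       ∎
  where open ≡-Reasoning

-- Over a repetition-free list containing γ, the syndrome of e γ is γ.
-- (Abstracting over  α ≟ᵥ γ  also evaluates the indicator  e γ α  in the goal.)
syn-e-present : ∀ {m} {γ : Fm m} {L : List (Fm m)} → Unique L → γ ∈ L → syn L (e γ) ≡ γ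
syn-e-present {γ = γ} {α ∷ L} uL@(_ ∷ uL') γ∈ with α ≟ᵥ γ | γ∈
... | yes refl | _ = trans (cong (α ⊕_) (syn-e-absent L (Unique.Unique[x∷xs]⇒x∉xs uL)))
                           (⊕-identityʳ α)
... | no  α≢γ  | here γ≡α  = ⊥-elim (α≢γ (sym γ≡α))
... | no  _    | there γ∈L = trans (⊕-identityˡ _) (syn-e-present uL' γ∈L)

-- The syndrome of e^γ is γ: for γ ≠ 0 it occurs once in \dot F^m, and e^0
-- vanishes on \dot F^m.
syndrome-e : ∀ {m} (γ : Fm m) → syn (nonzeroFm m) (e γ) ≡ γ
syndrome-e {m} γ with γ ≟ᵥ 0ᵐ m
... | yes refl = syn-e-absent (nonzeroFm m) (λ 0∈ → nonzeroFm-nonzero m 0∈ refl)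
... | no  γ≢0  = syn-e-present (nonzeroFm-unique m) (nonzeroFm-complete m γ≢0)

Rcomp-+w : ∀ {m} {ι : Fm m} {c d : Word m} →
  Rcomp m ι c → Rcomp m ι d → Rcomp m ι (c +w d)
Rcomp-+w {m} {ι} {c} {d} (Hc , symc) (Hd , symd) = Hcd , symcd
  where
  Hcd : Hamming m (c +w d)
  Hcd = begin
    syn (nonzeroFm m) (c +w d)                     ≡⟨ syn-+w (nonzeroFm m) c d ⟩
    syn (nonzeroFm m) c ⊕ syn (nonzeroFm m) d      ≡⟨ cong₂ _⊕_ Hc Hd ⟩
    0ᵐ m ⊕ 0ᵐ m                                    ≡⟨ ⊕-identityˡ _ ⟩
    0ᵐ m                                           ∎
    where open ≡-Reasoning
  symcd : (α : Fm m) → α ≢ 0ᵐ m → α ≢ ι → (c +w d) α ≡ (c +w d) (α ⊕ ι)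
  symcd = λ α α≢0 α≢ι → cong₂ _xor_ (symc α α≢0 α≢ι) (symd α α≢0 α≢ι)

-- The words  e^ι + e^γ + e^{γ+ι}  (of weight 3, or 1 when γ ∈ {0, ι}).
triad : ∀ {m} → Fm m → Fm m → Word m
triad ι γ = (e ι +w e γ) +w e (γ ⊕ ι)

triad-syndrome : ∀ {m} (ι γ : Fm m) → Hamming m (triad ι γ)
triad-syndrome {m} ι γ = begin
  syn N ((e ι +w e γ) +w e (γ ⊕ ι))                   ≡⟨ syn-+w N (e ι +w e γ) (e (γ ⊕ ι)) ⟩
  syn N (e ι +w e γ) ⊕ syn N (e (γ ⊕ ι))             ≡⟨ cong (_⊕ syn N (e (γ ⊕ ι))) (syn-+w N (e ι) (e γ)) ⟩
  (syn N (e ι) ⊕ syn N (e γ)) ⊕ syn N (e (γ ⊕ ι))    ≡⟨ cong₂ _⊕_ (cong₂ _⊕_ (syndrome-e ι) (syndrome-e γ))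
                                                                   (syndrome-e (γ ⊕ ι)) ⟩
  (ι ⊕ γ) ⊕ (γ ⊕ ι)                                  ≡⟨ cong ((ι ⊕ γ) ⊕_) (⊕-comm γ ι) ⟩
  (ι ⊕ γ) ⊕ (ι ⊕ γ)                                  ≡⟨ ⊕-self (ι ⊕ γ) ⟩
  0ᵐ m                                               ∎
  where
  N = nonzeroFm m
  open ≡-Reasoning

-- Swapping the coordinates α and α + ι merely permutes the three summands.
triad-symmetric : ∀ {m} (ι γ α : Fm m) → α ≢ 0ᵐ m → α ≢ ι →
  triad ι γ α ≡ triad ι γ (α ⊕ ι)
triad-symmetric ι γ α α≢0 α≢ι = begin
  (e ι α xor e γ α) xor e (γ ⊕ ι) α                   ≡⟨ cong (λ b → (b xor e γ α) xor e (γ ⊕ ι) α) (e-other α≢ι) ⟩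
  e γ α xor e (γ ⊕ ι) α                               ≡⟨ BP.xor-comm (e γ α) (e (γ ⊕ ι) α) ⟩
  e (γ ⊕ ι) α xor e γ α                               ≡⟨ cong₂ _xor_ (sym (e-translate γ α ι)) γ-side ⟩
  e γ (α ⊕ ι) xor e (γ ⊕ ι) (α ⊕ ι)                   ≡⟨ cong (λ b → (b xor e γ (α ⊕ ι)) xor e (γ ⊕ ι) (α ⊕ ι))
                                                               (sym (e-other α⊕ι≢ι)) ⟩
  (e ι (α ⊕ ι) xor e γ (α ⊕ ι)) xor e (γ ⊕ ι) (α ⊕ ι) ∎
  where
  open ≡-Reasoning
  α⊕ι≢ι : α ⊕ ι ≢ ι
  α⊕ι≢ι α⊕ι≡ι = α≢0 (trans (⊕-shift ι α⊕ι≡ι) (⊕-self ι))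
  γ-side : e γ α ≡ e (γ ⊕ ι) (α ⊕ ι)
  γ-side = sym (trans (e-translate (γ ⊕ ι) α ι) (cong (λ β → e β α) (⊕-cancelʳ γ ι)))

triad-∈-R : ∀ {m} (ι γ : Fm m) → Rcomp m ι (triad ι γ)
triad-∈-R ι γ = triad-syndrome ι γ , triad-symmetric ι γ

support : ∀ {m} → Word m → List (Fm m)
support {m} d = filter (λ α → T? (d α)) (nonzeroFm m)

weight : ∀ {m} → Word m → ℕ
weight d = length (support d)

∈-support⁺ : ∀ {m} {d : Word m} {α : Fm m} → α ≢ 0ᵐ m → d α ≡ true → α ∈ support d
∈-support⁺ {m} {d} α≢0 dα =
  ∈-filter⁺ (λ α → T? (d α)) (nonzeroFm-complete m α≢0) (Equivalence.from BP.T-≡ dα)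

∈-support⁻ : ∀ {m} {d : Word m} {α : Fm m} → α ∈ support d → α ≢ 0ᵐ m × d α ≡ true
∈-support⁻ {m} {d} α∈ with ∈-filter⁻ (λ α → T? (d α)) {xs = nonzeroFm m} α∈
... | α∈N , Tdα = nonzeroFm-nonzero m α∈N , Equivalence.to BP.T-≡ Tdα

unique-constant-length : ∀ {A : Set} {γ : A} {xs : List A} →
  Unique xs → All (_≡ γ) xs → length xs ≤ 1
unique-constant-length {xs = []}        _                _                = z≤n
unique-constant-length {xs = _ ∷ []}    _                _                = s≤s z≤n
unique-constant-length {xs = _ ∷ _ ∷ _} ((x≢y ∷ _) ∷ _) (refl ∷ refl ∷ _) = ⊥-elim (x≢y refl)

length≤1-members : ∀ {A : Set} {x y : A} {xs : List A} → length xs ≤ 1 → x ∈ xs → y ∈ xs → x ≡ y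
length≤1-members {xs = _ ∷ []}    _        (here x≡z) (here y≡z) = trans x≡z (sym y≡z)
length≤1-members {xs = _ ∷ []}    _        (there ())  _
length≤1-members {xs = _ ∷ []}    _        _           (there ())
length≤1-members {xs = _ ∷ _ ∷ _} (s≤s ()) _           _

≈e-intro : ∀ {m} (d : Word m) (γ : Fm m) →
  (∀ {α} → α ≢ 0ᵐ m → d α ≡ true → α ≡ γ) →
  (∀ {α} → α ≢ 0ᵐ m → α ≡ γ → d α ≡ true) → d ≈w e γ
≈e-intro d γ only-γ at-γ α α≢0 with α ≟ᵥ γ
... | yes α≡γ = at-γ α≢0 α≡γ
... | no  α≢γ = BP.¬-not (α≢γ ∘ only-γ α≢0)

weight-indicator : ∀ {m} (d : Word m) (γ : Fm m) → d ≈w e γ → weight d ≤ 1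
weight-indicator {m} d γ d≈eγ = unique-constant-length
  (Unique.filter⁺ (λ α → T? (d α)) (nonzeroFm-unique m))
  (tabulate λ α∈ →
    let α≢0 , dα = ∈-support⁻ α∈ in e-support (trans (sym (d≈eγ _ α≢0)) dα))

weight≤1⇒indicator : ∀ {m} (d : Word m) → weight d ≤ 1 → Σ (Fm m) λ γ → d ≈w e γ
weight≤1⇒indicator {m} d wt≤1 with support d in supp
... | []    = 0ᵐ m , ≈e-intro d (0ᵐ m)
  (λ α≢0 dα → ⊥-elim (∉[] (subst (_ ∈_) supp (∈-support⁺ α≢0 dα))))
  (λ α≢0 α≡0 → ⊥-elim (α≢0 α≡0))
... | γ ∷ _ = γ , ≈e-intro d γ
  (λ α≢0 dα → length≤1-members wt≤1 (subst (_ ∈_) supp (∈-support⁺ α≢0 dα)) (here refl))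
  (λ { _ refl → proj₂ (∈-support⁻ (subst (γ ∈_) (sym supp) (here refl))) })

+ˢ-assoc : ∀ {m} (M : Word m → Set) (u v : Word m) → ((M +ˢ u) +ˢ v) ⊆ (M +ˢ (u +w v))
+ˢ-assoc M u v (x , (c , Mc , x≈c+u) , w≈x+v) = c , Mc , λ α α≢0 → begin
  _                      ≡⟨ w≈x+v α α≢0 ⟩
  x α xor v α            ≡⟨ cong (_xor v α) (x≈c+u α α≢0) ⟩
  (c α xor u α) xor v α  ≡⟨ BP.xor-assoc (c α) (u α) (v α) ⟩
  c α xor (u α xor v α)  ∎
  where open ≡-Reasoning

+ˢ-cong : ∀ {m} (M : Word m → Set) {u u' : Word m} → u ≈w u' → (M +ˢ u) ⊆ (M +ˢ u')
+ˢ-cong M u≈u' (c , Mc , w≈c+u) =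
  c , Mc , λ α α≢0 → trans (w≈c+u α α≢0) (cong (c α xor_) (u≈u' α α≢0))

+w-cancelʳ : ∀ {m} (u v : Word m) → ((u +w v) +w v) ≈w u
+w-cancelʳ u v α _ = begin
  (u α xor v α) xor v α  ≡⟨ BP.xor-assoc (u α) (v α) (v α) ⟩
  u α xor (v α xor v α)  ≡⟨ cong (u α xor_) (BP.xor-same (v α)) ⟩
  u α xor false          ≡⟨ BP.xor-identityʳ (u α) ⟩
  u α                    ∎
  where open ≡-Reasoning

Ω-mono : ∀ {m} {M M' : Word m → Set} → M ⊆ M' → Ω M ⊆ Ω M'
Ω-mono M⊆M' (c , Mc , close) = c , M⊆M' Mc , close

-- The bit-level computation behind the key step: if  x = c + v  and
-- x + w = g, then  (c + (i + g + k)) + v + i + w = k.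
shift-bits : ∀ c v w i k {g} → (c xor v) xor w ≡ g →
  ((((c xor ((i xor g) xor k)) xor v) xor i) xor w) ≡ k
shift-bits c v w i k refl = solve 5
  (λ c v w i k → ((((c :+ ((i :+ ((c :+ v) :+ w)) :+ k)) :+ v) :+ i) :+ w) := k)
  refl c v w i k
  where open xor-∧-Solver

-- If  x = c + v  and  x + w = e^γ, the required word is
-- (c + triad ι γ) + v + e^ι, which differs from w exactly at γ + ι.
Ω-translate-e : ∀ {m} (ι : Fm m) (v : Word m) →
  Ω (Rcomp m ι +ˢ v) ⊆ Ω ((Rcomp m ι +ˢ v) +ˢ e ι)
Ω-translate-e {m} ι v {w} (x , (c , Rc , x≈c+v) , x~w) with weight≤1⇒indicator (x +w w) x~w
... | γ , x+w≈eγ = (c' +w v) +w e ι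
                 , (c' +w v , (c' , Rcomp-+w Rc (triad-∈-R ι γ) , λ _ _ → refl) , λ _ _ → refl)
                 , weight-indicator _ (γ ⊕ ι) agree
  where
  c' : Word m
  c' = c +w triad ι γ
  agree : (((c' +w v) +w e ι) +w w) ≈w e (γ ⊕ ι)
  agree α α≢0 = shift-bits (c α) (v α) (w α) (e ι α) (e (γ ⊕ ι) α)
    (trans (cong (_xor w α) (sym (x≈c+v α α≢0))) (x+w≈eγ α α≢0))

-- The theorem: Ω(R_ι + z) = Ω(R_ι + z + e^ι).  The second inclusion is the key
-- step for the translate z + e^ι, since (R_ι + z + e^ι) + e^ι = R_ι + z.
lemma1 : (m : ℕ) → m ≥ 1 → (ι : Fm m) → ι ≢ 0ᵐ m → (z : Word m) →
    (w : Word m) →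
      (Ω (Rcomp m ι +ˢ z) w → Ω ((Rcomp m ι +ˢ z) +ˢ e ι) w)
      × (Ω ((Rcomp m ι +ˢ z) +ˢ e ι) w → Ω (Rcomp m ι +ˢ z) w)
lemma1 m _ ι _ z w = Ω-translate-e ι z , backward
  where
  R : Word m → Set
  R = Rcomp m ι
  backward : Ω ((R +ˢ z) +ˢ e ι) w → Ω (R +ˢ z) w
  backward near = Ω-mono (λ p → +ˢ-cong R (+w-cancelʳ z (e ι)) (+ˢ-assoc R (z +w e ι) (e ι) p))
                    (Ω-translate-e ι (z +w e ι)
                      (Ω-mono (+ˢ-assoc R z (e ι)) near))
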